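{- Let $k\geq 1$ and $\tau\in S_k(213,231)$. Then: (i) for every $1\leq i\leq k-1$, $\tau_i$ is either a right maximum or a right minimum of $\tau$, i.e. either $\tau_i>\tau_j$ for all $j>i$, or $\tau_i<\tau_j$ for all $j>i$; (ii) the generating function $d_\tau(x)=\sum_{n\geq 0}|S_n(213,231,\tau)|x^n$ equals $\det M$, where $M$ is the $k\times k$ matrix with $M_{i,1}=1$ for all $1\leq i\leq k$, $M_{i,i}=1$ for $2\leq i\leq k$, $M_{i,i+1}=-g(x)$ for $1\leq i\leq k-1$, and all other entries $0$, with $g(x)=\frac{x}{1-x}$: $$d_\tau(x)=\left|\begin{array}{ccccc} 1 & -g(x) & 0 & \dots & 0\\ 1 & 1 & -g(x) & \dots & 0\\ \vdots & \vdots & \ddots & \ddots & \vdots\\ 1 & 0 & \dots & 1 & -g(x)\\ 1 & 0 & \dots & 0 & 1 \end{array}\right|.$$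
   Context: Permutations are written in one-line notation; $S_k$ is the set of permutations of $\{1,\dots,k\}$, $S_0$ consists of the empty permutation. A permutation $\alpha\in S_n$ contains a pattern $\beta$ if some subsequence of $\alpha$ is order-isomorphic to $\beta$; otherwise it avoids $\beta$. $S_n(\beta^1,\dots,\beta^s)$ is the set of permutations in $S_n$ avoiding each $\beta^i$. -}

module Defs where

open import Data.Bool using (Bool; true; false; _∧_; _∨_; not; if_then_else_)
open import Data.Nat using (ℕ; zero; suc; _≡ᵇ_; _<ᵇ_; _∸_)
open import Data.List using (List; []; _∷_; _++_; length; map; concatMap; applyUpTo; zip)
open import Data.Product using (_×_; _,_; proj₁; proj₂)
open import Data.Fin using (Fin; toℕ; punchIn)
import Data.Fin as F
open import Relation.Binary.PropositionalEquality using (_≡_)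
open import Data.Integer using (ℤ; +_; -_) renaming (_+_ to _+ℤ_; _*_ to _*ℤ_)

anyB : {A : Set} → (A → Bool) → List A → Bool
anyB p [] = false
anyB p (x ∷ xs) = p x ∨ anyB p xs

allB : {A : Set} → (A → Bool) → List A → Bool
allB p [] = true
allB p (x ∷ xs) = p x ∧ allB p xs

filterB : {A : Set} → (A → Bool) → List A → List A
filterB p [] = []
filterB p (x ∷ xs) = if p x then x ∷ filterB p xs else filterB p xs

eqB : Bool → Bool → Bool
eqB true b = b
eqB false b = not b

subseqs : {A : Set} → List A → List (List A)
subseqs [] = [] ∷ []
subseqs (x ∷ xs) = map (x ∷_) (subseqs xs) ++ subseqs xs

orderIso : List ℕ → List ℕ → Bool
orderIso a b = (length a ≡ᵇ length b) ∧
  allB (λ p → allB (λ q → eqB (proj₁ p <ᵇ proj₁ q) (proj₂ p <ᵇ proj₂ q)) z) z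
  where z = zip a b

contains : List ℕ → List ℕ → Bool
contains α β = anyB (λ s → orderIso s β) (subseqs α)

avoids : List ℕ → List ℕ → Bool
avoids α β = not (contains α β)

isPerm : ℕ → List ℕ → Bool
isPerm n w = (length w ≡ᵇ n) ∧ allB (λ v → anyB (v ≡ᵇ_) w) (applyUpTo suc n)

words : ℕ → ℕ → List (List ℕ)
words n zero = [] ∷ []
words n (suc m) = concatMap (λ v → map (v ∷_) (words n m)) (applyUpTo suc n)

Sn : ℕ → List (List ℕ)
Sn n = filterB (isPerm n) (words n n)

countAvoiders : ℕ → List (List ℕ) → ℕ
countAvoiders n βs = length (filterB (λ σ → allB (avoids σ) βs) (Sn n))

PS : Set
PS = ℕ → ℤ

_≈PS_ : PS → PS → Set
f ≈PS g = ∀ n → f n ≡ g n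

zeroPS : PS
zeroPS n = + 0

onePS : PS
onePS zero = + 1
onePS (suc n) = + 0

_⊕_ : PS → PS → PS
(f ⊕ g) n = f n +ℤ g n

negPS : PS → PS
negPS f n = - f n

scalePS : ℤ → PS → PS
scalePS c f n = c *ℤ f n

convSum : PS → PS → ℕ → ℕ → ℤ
convSum f g n zero = f 0 *ℤ g n
convSum f g n (suc j) = f (suc j) *ℤ g (n ∸ suc j) +ℤ convSum f g n j

_⊛_ : PS → PS → PS
(f ⊛ g) n = convSum f g n n

-- g(x) = x/(1-x) = x + x² + x³ + …
gPS : PS
gPS zero = + 0
gPS (suc n) = + 1

sumPS : ∀ n → (Fin n → PS) → PS
sumPS zero f = zeroPS
sumPS (suc n) f = f F.zero ⊕ sumPS n (λ j → f (F.suc j))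

sgn : ℕ → ℤ
sgn zero = + 1
sgn (suc n) = - sgn n

det : ∀ n → (Fin n → Fin n → PS) → PS
det zero M = onePS
det (suc n) M = sumPS (suc n) (λ j →
  scalePS (sgn (toℕ j)) (M F.zero j ⊛ det n (λ a b → M (F.suc a) (punchIn j b))))

-- The k×k matrix M of the theorem (0-indexed rows i and columns j):
-- column 0 all 1; diagonal 1; superdiagonal -g(x); 0 elsewhere.
Mτ : ∀ k → Fin k → Fin k → PS
Mτ k i j =
  if toℕ j ≡ᵇ 0 then onePS
  else if toℕ i ≡ᵇ toℕ j then onePS
  else if toℕ j ≡ᵇ suc (toℕ i) then negPS gPS
  else zeroPS

dτ : List ℕ → PS
dτ τ n = + countAvoiders n ((2 ∷ 1 ∷ 3 ∷ []) ∷ (2 ∷ 3 ∷ 1 ∷ []) ∷ τ ∷ [])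

-- A permutation avoids 213 and 231 exactly when each entry is smaller than all entries to
-- its right or larger than all of them; this is part (i).  Such a right-extremal
-- permutation of {1, …, n} is determined by its ascent word in {↑,↓}ⁿ⁻¹ (at an ascent the
-- entry is the smallest remaining value, at a descent the largest), and every word occurs.
-- In a right-extremal list an entry compares with every later entry as with its successor,
-- so σ contains τ iff the ascent word of τ is a subsequence of that of σ.  Hence
-- |Sₙ(213,231,τ)| is the number of binary words of length n − 1 avoiding a fixed word of
-- length k − 1 as a subsequence; greedy matching gives Pascal's rule for this count, so it
-- is Σ_{i<k−1} C(n − 1, i).  Expanding the determinant along its first row gives
-- Dₖ = 1 + g·Dₖ₋₁, i.e. det M = 1 + g + … + gᵏ⁻¹, whose coefficient of xⁿ (n ≥ 1) is the
-- same binomial sum.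

module Submission where

open import Defs
open import Data.Bool using (Bool; true; false; not; if_then_else_)
import Data.Bool
open import Data.Bool.Properties using (T-≡; ∧-conicalˡ; ∧-conicalʳ)
open import Data.Nat using (ℕ; zero; suc; _<_; _≤_; _+_; _≡ᵇ_; _<ᵇ_; _∸_; z≤n; s≤s; z<s)
open import Data.Nat.Properties
  using ( _≟_; _<?_; <⇒<ᵇ; <ᵇ⇒<; ≡ᵇ⇒≡; ≡⇒≡ᵇ; ≤-refl; ≤-reflexive; ≤-trans; ≤-antisym; ≤-pred; <-irrefl; <-asym
        ; <-trans; <-≤-trans; ≤-<-trans; <⇒≤; <⇒≢; ≤∧≢⇒<; ≮⇒≥; n<1+n; n≤1+n; m≤m+n; +-comm; +-suc
        ; +-identityʳ; +-monoʳ-≤; suc-injective)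
open import Data.List using (List; []; _∷_; _++_; zip; length; map; concatMap; applyUpTo; filter; filterᵇ)
open import Data.List.Properties
  using ( ∷-injectiveˡ; ∷-injectiveʳ; ++-identityʳ; length-++; length-map; length-applyUpTo; length-removeAt′
        ; filter-++; filter-none; filter-accept; filter-≐)
open import Data.List.Membership.Propositional using (_∈_; _─_; find; lose)
open import Data.List.Membership.Propositional.Properties
  using ( ∈-applyUpTo⁺; ∈-applyUpTo⁻; ∈-map⁺; ∈-map⁻; ∈-++⁺ˡ; ∈-++⁺ʳ; ∈-++⁻; ∈-concatMap⁺; ∈-concatMap⁻
        ; ∈-filter⁺; ∈-filter⁻)
open import Data.List.Relation.Unary.Any using (here; there; index)
open import Data.List.Relation.Unary.All using (All; []; _∷_)
import Data.List.Relation.Unary.All as All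
open import Data.List.Relation.Unary.All.Properties using (¬Any⇒All¬; ¬All⇒Any¬)
open import Data.List.Relation.Unary.Unique.Propositional using (Unique; []; _∷_)
import Data.List.Relation.Unary.Unique.Propositional.Properties as Unique
open import Data.List.Relation.Binary.Subset.Propositional using (_⊆_)
open import Data.List.Relation.Binary.Disjoint.Propositional using (Disjoint)
open import Data.List.Relation.Binary.Sublist.Propositional
  using ([]; _∷_; _∷ʳ_; from∈; minimum) renaming (_⊆_ to _⊑_; lookup to ⊑-lookup)
open import Data.List.Relation.Binary.Sublist.Propositional.Properties using (All-resp-⊆; ∷⁻¹; ∷ʳ⁻¹)
open import Data.List.Relation.Binary.Sublist.DecPropositional Data.Bool._≟_ using () renaming (_⊆?_ to _⊑?_)
open import Data.Integer using (ℤ; +_; -_) renaming (_+_ to _+ℤ_; _*_ to _*ℤ_)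
import Data.Integer.Properties as ℤ
open import Data.Fin using (Fin; toℕ; punchIn)
open import Data.Vec using (Vec; []; _∷_; lookup; toList)
import Data.Vec.Properties as Vec
import Data.Vec.Relation.Unary.All.Properties as Vec
import Data.Fin as Fin
open import Data.Product using (_×_; _,_; proj₁; proj₂; ∃-syntax; uncurry)
open import Data.Sum using (_⊎_; inj₁; inj₂)
import Data.Sum as Sum
open import Data.Empty using (⊥; ⊥-elim)
open import Function using (_∘_; Equivalence; _⇔_)
open import Relation.Nullary using (¬_; yes; no; ¬?; does)
open import Relation.Unary using (Decidable; _≐_)
open import Relation.Nullary.Decidable using (T?)
open import Relation.Binary.Definitions using (DecidableEquality)
open import Relation.Binary.PropositionalEquality
  using (_≡_; _≢_; refl; sym; trans; cong; cong₂; subst; module ≡-Reasoning)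

<⇒<ᵇ≡true : ∀ {m n} → m < n → (m <ᵇ n) ≡ true
<⇒<ᵇ≡true m<n = Equivalence.to T-≡ (<⇒<ᵇ m<n)

<ᵇ≡true⇒< : ∀ {m n} → (m <ᵇ n) ≡ true → m < n
<ᵇ≡true⇒< {m} {n} eq = <ᵇ⇒< m n (Equivalence.from T-≡ eq)

≤⇒<ᵇ≡false : ∀ {m n} → n ≤ m → (m <ᵇ n) ≡ false
≤⇒<ᵇ≡false {m} {n} n≤m with m <ᵇ n in eq
... | true  = ⊥-elim (<-irrefl refl (<-≤-trans (<ᵇ≡true⇒< eq) n≤m))
... | false = refl

n<ᵇn≡false : ∀ n → (n <ᵇ n) ≡ false
n<ᵇn≡false n = ≤⇒<ᵇ≡false {n} ≤-refl

≤⇒<+suc : ∀ {v} lo n → v ≤ lo + n → v < lo + suc n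
≤⇒<+suc {v} lo n v≤ = subst (v <_) (sym (+-suc lo n)) (s≤s v≤)

module _ {A : Set} where

  ∈-─⁺ : ∀ {x z : A} {ys} (x∈ys : x ∈ ys) → z ∈ ys → z ≢ x → z ∈ ys ─ x∈ys
  ∈-─⁺ (here refl) (here refl) z≢x = ⊥-elim (z≢x refl)
  ∈-─⁺ (here refl) (there z∈ys) _  = z∈ys
  ∈-─⁺ (there _)   (here refl) _   = here refl
  ∈-─⁺ (there x∈ys) (there z∈ys) z≢x = there (∈-─⁺ x∈ys z∈ys z≢x)

  Unique-⊆⇒length≤ : ∀ {xs ys : List A} → Unique xs → xs ⊆ ys → length xs ≤ length ys
  Unique-⊆⇒length≤ {[]} _ _ = z≤n
  Unique-⊆⇒length≤ {x ∷ xs} {ys} (x≢xs ∷ u) xs⊆ys =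
    subst (suc (length xs) ≤_) (sym (length-removeAt′ ys (index x∈ys)))
      (s≤s (Unique-⊆⇒length≤ u λ z∈xs →
        ∈-─⁺ x∈ys (xs⊆ys (there z∈xs)) (λ z≡x → All.lookup x≢xs z∈xs (sym z≡x))))
    where x∈ys = xs⊆ys (here refl)

  Unique-⊆-⊇⇒length≡ : ∀ {xs ys : List A} → Unique xs → Unique ys → xs ⊆ ys → ys ⊆ xs →
                       length xs ≡ length ys
  Unique-⊆-⊇⇒length≡ uxs uys xs⊆ys ys⊆xs =
    ≤-antisym (Unique-⊆⇒length≤ uxs xs⊆ys) (Unique-⊆⇒length≤ uys ys⊆xs)

module _ {A : Set} (_≟_ : DecidableEquality A) where
  open import Data.List.Membership.DecPropositional _≟_ using (_∈?_)

  Unique⊎shorterSuperset : (xs : List A) → Unique xs ⊎ ∃[ ys ] length ys < length xs × xs ⊆ ys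
  Unique⊎shorterSuperset [] = inj₁ []
  Unique⊎shorterSuperset (x ∷ xs) with x ∈? xs
  ... | yes x∈xs = inj₂ (xs , n<1+n _ , λ { (here refl) → x∈xs ; (there z∈xs) → z∈xs })
  ... | no x∉xs with Unique⊎shorterSuperset xs
  ...   | inj₁ u = inj₁ (¬Any⇒All¬ xs x∉xs ∷ u)
  ...   | inj₂ (ys , shorter , xs⊆ys) =
    inj₂ (x ∷ ys , s≤s shorter , λ { (here refl) → here refl ; (there z∈xs) → there (xs⊆ys z∈xs) })

  covers-Unique⇒Unique : ∀ {xs ys : List A} → Unique ys → ys ⊆ xs → length xs ≤ length ys → Unique xs
  covers-Unique⇒Unique {xs} uys ys⊆xs short with Unique⊎shorterSuperset xs
  ... | inj₁ u = u
  ... | inj₂ (zs , shorter , xs⊆zs) =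
    ⊥-elim (<-irrefl refl (≤-<-trans (≤-trans short (Unique-⊆⇒length≤ uys (xs⊆zs ∘ ys⊆xs))) shorter))

All-zip : ∀ {A B : Set} {P : A → Set} {Q : B → Set} {xs ys} → All P xs → All Q ys →
          All (λ q → P (proj₁ q) × Q (proj₂ q)) (zip xs ys)
All-zip []       _        = []
All-zip (_ ∷ _)  []       = []
All-zip (p ∷ ps) (q ∷ qs) = (p , q) ∷ All-zip ps qs

pair-⊑ : ∀ {A : Set} {y z : A} {xs} → y ∈ xs → z ∈ xs → y ≢ z →
         (y ∷ z ∷ []) ⊑ xs ⊎ (z ∷ y ∷ []) ⊑ xs
pair-⊑ (here refl) (here refl)  y≢z = ⊥-elim (y≢z refl)
pair-⊑ (here refl) (there z∈xs) _   = inj₁ (refl ∷ from∈ z∈xs)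
pair-⊑ (there y∈xs) (here refl) _   = inj₂ (refl ∷ from∈ y∈xs)
pair-⊑ (there y∈xs) (there z∈xs) y≢z = Sum.map (_ ∷ʳ_) (_ ∷ʳ_) (pair-⊑ y∈xs z∈xs y≢z)

¬-≐ : ∀ {A : Set} {P Q : A → Set} → (∀ {x} → P x ⇔ Q x) → (λ x → ¬ Q x) ≐ (λ x → ¬ P x)
¬-≐ P⇔Q = (λ ¬q p → ¬q (Equivalence.to P⇔Q p)) , (λ ¬p q → ¬p (Equivalence.from P⇔Q q))

length-filter-map : ∀ {A B : Set} {P : B → Set} (P? : Decidable P) (f : A → B) xs →
  length (filter P? (map f xs)) ≡ length (filter (P? ∘ f) xs)
length-filter-map P? f []       = refl
length-filter-map P? f (x ∷ xs) with does (P? (f x))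
... | true  = cong suc (length-filter-map P? f xs)
... | false = length-filter-map P? f xs

module _ {A : Set} where

  wordsOver : List A → ℕ → List (List A)
  wordsOver ks zero    = [] ∷ []
  wordsOver ks (suc m) = concatMap (λ v → map (v ∷_) (wordsOver ks m)) ks

  ∈-wordsOver⁻ : ∀ ks m {w} → w ∈ wordsOver ks m → length w ≡ m × All (_∈ ks) w
  ∈-wordsOver⁻ ks zero (here refl) = refl , []
  ∈-wordsOver⁻ ks (suc m) w∈
    with k , k∈ks , w∈k ← find (∈-concatMap⁻ (λ v → map (v ∷_) (wordsOver ks m)) {xs = ks} w∈)
    with w , w∈ , refl ← ∈-map⁻ (k ∷_) w∈k
    = let len , all = ∈-wordsOver⁻ ks m w∈ in cong suc len , k∈ks ∷ all

  ∈-wordsOver⁺ : ∀ ks m {w} → length w ≡ m → All (_∈ ks) w → w ∈ wordsOver ks m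
  ∈-wordsOver⁺ ks zero    {[]}    _   []            = here refl
  ∈-wordsOver⁺ ks (suc m) {k ∷ w} len (k∈ks ∷ all) =
    ∈-concatMap⁺ (λ v → map (v ∷_) (wordsOver ks m))
      (lose k∈ks (∈-map⁺ (k ∷_) (∈-wordsOver⁺ ks m (suc-injective len) all)))

  Unique-wordsOver : ∀ {ks} m → Unique ks → Unique (wordsOver ks m)
  Unique-wordsOver zero    _  = [] ∷ []
  Unique-wordsOver {ks} (suc m) uks = Unique-extensions uks
    where
      W = wordsOver ks m
      Unique-extensions : ∀ {js} → Unique js → Unique (concatMap (λ v → map (v ∷_) W) js)
      Unique-extensions [] = []
      Unique-extensions {j ∷ js} (j≢js ∷ ujs) =
        Unique.++⁺ (Unique.map⁺ ∷-injectiveʳ (Unique-wordsOver m uks)) (Unique-extensions ujs) disjoint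
        where
          disjoint : Disjoint (map (j ∷_) W) (concatMap (λ v → map (v ∷_) W) js)
          disjoint (w∈ , w∈′)
            with _ , _ , refl ← ∈-map⁻ _ w∈
            with k , k∈js , w∈k ← find (∈-concatMap⁻ (λ v → map (v ∷_) W) {xs = js} w∈′)
            with _ , _ , refl ← ∈-map⁻ (k ∷_) w∈k
            = All.lookup j≢js k∈js refl

module _ {A : Set} (p : A → Bool) where

  allB⇒All : ∀ xs → allB p xs ≡ true → All (λ x → p x ≡ true) xs
  allB⇒All [] _ = []
  allB⇒All (x ∷ xs) eq with p x in px
  allB⇒All (x ∷ xs) eq | true = px ∷ allB⇒All xs eq

  All⇒allB : ∀ {xs} → All (λ x → p x ≡ true) xs → allB p xs ≡ true
  All⇒allB [] = refl
  All⇒allB (px ∷ pxs) rewrite px = All⇒allB pxs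

  anyB⇒∃ : ∀ xs → anyB p xs ≡ true → ∃[ x ] x ∈ xs × p x ≡ true
  anyB⇒∃ (x ∷ xs) eq with p x in px
  ... | true  = x , here refl , px
  ... | false = let y , y∈xs , py = anyB⇒∃ xs eq in y , there y∈xs , py

  ∈⇒anyB : ∀ {x xs} → x ∈ xs → p x ≡ true → anyB p xs ≡ true
  ∈⇒anyB (here refl) px rewrite px = refl
  ∈⇒anyB {xs = y ∷ _} (there x∈xs) px with p y
  ... | true  = refl
  ... | false = ∈⇒anyB x∈xs px

  filterB≡filterᵇ : ∀ xs → filterB p xs ≡ filterᵇ p xs
  filterB≡filterᵇ [] = refl
  filterB≡filterᵇ (x ∷ xs) with p x
  ... | true  = cong (x ∷_) (filterB≡filterᵇ xs)
  ... | false = filterB≡filterᵇ xs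

  ∈-filterB⁻ : ∀ {x} xs → x ∈ filterB p xs → x ∈ xs × p x ≡ true
  ∈-filterB⁻ xs x∈ =
    let x∈xs , px = ∈-filter⁻ (T? ∘ p) (subst (_ ∈_) (filterB≡filterᵇ xs) x∈)
    in x∈xs , Equivalence.to T-≡ px

  ∈-filterB⁺ : ∀ {x xs} → x ∈ xs → p x ≡ true → x ∈ filterB p xs
  ∈-filterB⁺ {xs = xs} x∈xs px =
    subst (_ ∈_) (sym (filterB≡filterᵇ xs)) (∈-filter⁺ (T? ∘ p) x∈xs (Equivalence.from T-≡ px))

  Unique-filterB : ∀ {xs} → Unique xs → Unique (filterB p xs)
  Unique-filterB {xs} u = subst Unique (sym (filterB≡filterᵇ xs)) (Unique.filter⁺ (T? ∘ p) u)

-- Occurrences of patterns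

module _ {A : Set} where

  ∈-subseqs⁻ : ∀ (xs : List A) {ys} → ys ∈ subseqs xs → ys ⊑ xs
  ∈-subseqs⁻ [] (here refl) = []
  ∈-subseqs⁻ (x ∷ xs) ys∈ with ∈-++⁻ (map (x ∷_) (subseqs xs)) ys∈
  ... | inj₂ ys∈′ = x ∷ʳ ∈-subseqs⁻ xs ys∈′
  ... | inj₁ ys∈′ with _ , zs∈ , refl ← ∈-map⁻ (x ∷_) ys∈′ = refl ∷ ∈-subseqs⁻ xs zs∈

  ∈-subseqs⁺ : ∀ {xs ys : List A} → ys ⊑ xs → ys ∈ subseqs xs
  ∈-subseqs⁺ []                          = here refl
  ∈-subseqs⁺ (_∷ʳ_ {ys = xs} x ys⊑xs)    = ∈-++⁺ʳ (map (x ∷_) (subseqs xs)) (∈-subseqs⁺ ys⊑xs)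
  ∈-subseqs⁺ (refl ∷ ys⊑xs)              = ∈-++⁺ˡ (∈-map⁺ _ (∈-subseqs⁺ ys⊑xs))

avoids⁻ : ∀ {α β s} → avoids α β ≡ true → s ⊑ α → orderIso s β ≢ true
avoids⁻ {β = β} av s⊑α iso
  with () ← subst (λ b → not b ≡ true) (∈⇒anyB (λ s → orderIso s β) (∈-subseqs⁺ s⊑α) iso) av

avoids⁺ : ∀ {α β} → (∀ {s} → s ⊑ α → orderIso s β ≢ true) → avoids α β ≡ true
avoids⁺ {α} {β} no-occurrence with contains α β in occ
... | false = refl
... | true  = let _ , s∈ , iso = anyB⇒∃ (λ s → orderIso s β) (subseqs α) occ
              in ⊥-elim (no-occurrence (∈-subseqs⁻ α s∈) iso)

avoids-∷⁻ : ∀ {x} xs β → avoids (x ∷ xs) β ≡ true → avoids xs β ≡ true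
avoids-∷⁻ {x} xs β av = avoids⁺ {xs} {β} λ s⊑xs → avoids⁻ {x ∷ xs} {β} av (x ∷ʳ s⊑xs)

eqB≡true⇒≡ : ∀ {b c} → eqB b c ≡ true → b ≡ c
eqB≡true⇒≡ {true}  {true}  _ = refl
eqB≡true⇒≡ {false} {false} _ = refl

≡⇒eqB≡true : ∀ {b c} → b ≡ c → eqB b c ≡ true
≡⇒eqB≡true {true}  refl = refl
≡⇒eqB≡true {false} refl = refl

Agree : ℕ × ℕ → ℕ × ℕ → Set
Agree (a , b) (c , d) = (a <ᵇ c) ≡ (b <ᵇ d)

PairwiseAgree : List (ℕ × ℕ) → Set
PairwiseAgree z = All (λ p → All (Agree p) z) z

orderIso⁻ : ∀ s t → orderIso s t ≡ true → length s ≡ length t × PairwiseAgree (zip s t)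
orderIso⁻ s t iso =
  ≡ᵇ⇒≡ _ _ (Equivalence.from T-≡ (∧-conicalˡ _ _ iso)) ,
  All.map (All.map eqB≡true⇒≡ ∘ allB⇒All _ _) (allB⇒All _ (zip s t) (∧-conicalʳ _ _ iso))

orderIso⁺ : ∀ s t → length s ≡ length t → PairwiseAgree (zip s t) → orderIso s t ≡ true
orderIso⁺ s t len agree
  rewrite Equivalence.to T-≡ (≡⇒≡ᵇ (length s) (length t) len) =
  All⇒allB _ (All.map (All⇒allB _ ∘ All.map ≡⇒eqB≡true) agree)

-- Right-extremal lists

module _ {A : Set} (_≺_ : A → A → Set) where

  RightEnd : A → List A → Set
  RightEnd x xs = All (x ≺_) xs ⊎ All (_≺ x) xs

  data RightExtremal : List A → Set where
    []  : RightExtremal []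
    _∷_ : ∀ {x xs} → RightEnd x xs → RightExtremal xs → RightExtremal (x ∷ xs)

  RightExtremal-⊑ : ∀ {xs ys} → xs ⊑ ys → RightExtremal ys → RightExtremal xs
  RightExtremal-⊑ []              r              = r
  RightExtremal-⊑ (_ ∷ʳ xs⊑ys)   (_ ∷ r)         = RightExtremal-⊑ xs⊑ys r
  RightExtremal-⊑ (refl ∷ xs⊑ys) (end ∷ r)     =
    Sum.map (All-resp-⊆ xs⊑ys) (All-resp-⊆ xs⊑ys) end ∷ RightExtremal-⊑ xs⊑ys r

avoids-of-triples : ∀ {σ} β → length β ≡ 3 →
  (∀ {a b c} → RightEnd _<_ a (b ∷ c ∷ []) → orderIso (a ∷ b ∷ c ∷ []) β ≢ true) →
  RightExtremal _<_ σ → avoids σ β ≡ true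
avoids-of-triples β len no-triple r =
  avoids⁺ λ {s} s⊑σ iso →
    no-occurrence (RightExtremal-⊑ _<_ s⊑σ r) iso (trans (proj₁ (orderIso⁻ s β iso)) len)
  where
    no-occurrence : ∀ {s} → RightExtremal _<_ s → orderIso s β ≡ true → length s ≡ 3 → ⊥
    no-occurrence {_ ∷ _ ∷ _ ∷ []}     (end ∷ _) iso _ = no-triple end iso
    no-occurrence {[]}                 _ _ ()
    no-occurrence {_ ∷ []}             _ _ ()
    no-occurrence {_ ∷ _ ∷ []}         _ _ ()
    no-occurrence {_ ∷ _ ∷ _ ∷ _ ∷ _} _ _ ()

RightExtremal⇒avoids-213 : ∀ {σ} → RightExtremal _<_ σ → avoids σ (2 ∷ 1 ∷ 3 ∷ []) ≡ true
RightExtremal⇒avoids-213 = avoids-of-triples _ refl no-213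
  where
    no-213 : ∀ {a b c} → RightEnd _<_ a (b ∷ c ∷ []) →
             orderIso (a ∷ b ∷ c ∷ []) (2 ∷ 1 ∷ 3 ∷ []) ≢ true
    no-213 {a} (inj₁ (a<b ∷ _)) iso rewrite n<ᵇn≡false a | <⇒<ᵇ≡true a<b with () ← iso
    no-213 {a} (inj₂ (b<a ∷ c<a ∷ [])) iso
      rewrite n<ᵇn≡false a | ≤⇒<ᵇ≡false (<⇒≤ b<a) | ≤⇒<ᵇ≡false (<⇒≤ c<a) with () ← iso

RightExtremal⇒avoids-231 : ∀ {σ} → RightExtremal _<_ σ → avoids σ (2 ∷ 3 ∷ 1 ∷ []) ≡ true
RightExtremal⇒avoids-231 = avoids-of-triples _ refl no-231
  where
    no-231 : ∀ {a b c} → RightEnd _<_ a (b ∷ c ∷ []) →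
             orderIso (a ∷ b ∷ c ∷ []) (2 ∷ 3 ∷ 1 ∷ []) ≢ true
    no-231 {a} (inj₁ (a<b ∷ a<c ∷ [])) iso
      rewrite n<ᵇn≡false a | <⇒<ᵇ≡true a<b | <⇒<ᵇ≡true a<c with () ← iso
    no-231 {a} (inj₂ (b<a ∷ _)) iso rewrite n<ᵇn≡false a | ≤⇒<ᵇ≡false (<⇒≤ b<a) with () ← iso

module _ {x y z : ℕ} (y<x : y < x) (x<z : x < z) where

  orderIso-213 : orderIso (x ∷ y ∷ z ∷ []) (2 ∷ 1 ∷ 3 ∷ []) ≡ true
  orderIso-213 rewrite n<ᵇn≡false x | n<ᵇn≡false y | n<ᵇn≡false z
    | <⇒<ᵇ≡true y<x | ≤⇒<ᵇ≡false {x} (<⇒≤ y<x) | <⇒<ᵇ≡true x<z | ≤⇒<ᵇ≡false {z} (<⇒≤ x<z)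
    | <⇒<ᵇ≡true (<-trans y<x x<z) | ≤⇒<ᵇ≡false {z} (<⇒≤ (<-trans y<x x<z)) = refl

  orderIso-231 : orderIso (x ∷ z ∷ y ∷ []) (2 ∷ 3 ∷ 1 ∷ []) ≡ true
  orderIso-231 rewrite n<ᵇn≡false x | n<ᵇn≡false y | n<ᵇn≡false z
    | <⇒<ᵇ≡true y<x | ≤⇒<ᵇ≡false {x} (<⇒≤ y<x) | <⇒<ᵇ≡true x<z | ≤⇒<ᵇ≡false {z} (<⇒≤ x<z)
    | <⇒<ᵇ≡true (<-trans y<x x<z) | ≤⇒<ᵇ≡false {z} (<⇒≤ (<-trans y<x x<z)) = refl

avoids⇒RightExtremal : ∀ {σ} → Unique σ →
  avoids σ (2 ∷ 1 ∷ 3 ∷ []) ≡ true → avoids σ (2 ∷ 3 ∷ 1 ∷ []) ≡ true → RightExtremal _<_ σ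
avoids⇒RightExtremal {[]} _ _ _ = []
avoids⇒RightExtremal {x ∷ xs} (x≢xs ∷ u) av-213 av-231 =
  head-end ∷ avoids⇒RightExtremal u (avoids-∷⁻ xs _ av-213) (avoids-∷⁻ xs _ av-231)
  where
    below : ∀ {y} → y ∈ xs → ¬ x < y → y < x
    below y∈xs x≮y = ≤∧≢⇒< (≮⇒≥ x≮y) (λ y≡x → All.lookup x≢xs y∈xs (sym y≡x))
    above : ∀ {z} → z ∈ xs → ¬ z < x → x < z
    above z∈xs z≮x = ≤∧≢⇒< (≮⇒≥ z≮x) (All.lookup x≢xs z∈xs)
    head-end : RightEnd _<_ x xs
    head-end with All.all? (x <?_) xs | All.all? (_<? x) xs
    ... | yes min | _       = inj₁ min
    ... | _       | yes max = inj₂ max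
    ... | no ¬min | no ¬max
      with y , y∈xs , x≮y ← find (¬All⇒Any¬ (x <?_) xs ¬min)
      with z , z∈xs , z≮x ← find (¬All⇒Any¬ (_<? x) xs ¬max)
      with y<x ← below y∈xs x≮y
      with x<z ← above z∈xs z≮x
      with pair-⊑ y∈xs z∈xs (λ { refl → <-asym y<x x<z })
    ... | inj₁ yz⊑xs = ⊥-elim (avoids⁻ av-213 (refl ∷ yz⊑xs) (orderIso-213 y<x x<z))
    ... | inj₂ zy⊑xs = ⊥-elim (avoids⁻ av-231 (refl ∷ zy⊑xs) (orderIso-231 y<x x<z))

RightExtremal⇒rightMaxOrMin : ∀ {k} (τ : Vec ℕ k) → RightExtremal _<_ (toList τ) → (i : Fin k) →
  ((j : Fin k) → toℕ i < toℕ j → lookup τ j < lookup τ i) ⊎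
  ((j : Fin k) → toℕ i < toℕ j → lookup τ i < lookup τ j)
RightExtremal⇒rightMaxOrMin (x ∷ τ) (inj₁ above ∷ _) Fin.zero =
  inj₂ λ { Fin.zero () ; (Fin.suc j) _ → Vec.lookup⁺ (Vec.toList⁻ above) j }
RightExtremal⇒rightMaxOrMin (x ∷ τ) (inj₂ below ∷ _) Fin.zero =
  inj₁ λ { Fin.zero () ; (Fin.suc j) _ → Vec.lookup⁺ (Vec.toList⁻ below) j }
RightExtremal⇒rightMaxOrMin (x ∷ τ) (_ ∷ r) (Fin.suc i) =
  Sum.map (later (λ a b → a < b)) (later (λ a b → b < a)) (RightExtremal⇒rightMaxOrMin τ r i)
  where
    later : ∀ (R : ℕ → ℕ → Set) → ((j : _) → toℕ i < toℕ j → R (lookup τ j) (lookup τ i)) →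
            (j : Fin _) → suc (toℕ i) < toℕ j → R (lookup (x ∷ τ) j) (lookup τ i)
    later R f (Fin.suc j) i<j = f j (≤-pred i<j)

-- Ascent words

ascents : List ℕ → List Bool
ascents []           = []
ascents (x ∷ [])     = []
ascents (x ∷ y ∷ xs) = (x <ᵇ y) ∷ ascents (y ∷ xs)

length-ascents : ∀ x xs → length (ascents (x ∷ xs)) ≡ length xs
length-ascents x []       = refl
length-ascents x (y ∷ xs) = cong suc (length-ascents y xs)

RightEnd⇒<ᵇ-constant : ∀ {x xs y z} → RightEnd _<_ x xs → y ∈ xs → z ∈ xs → (x <ᵇ y) ≡ (x <ᵇ z)
RightEnd⇒<ᵇ-constant (inj₁ min) y∈ z∈ =
  trans (<⇒<ᵇ≡true (All.lookup min y∈)) (sym (<⇒<ᵇ≡true (All.lookup min z∈)))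
RightEnd⇒<ᵇ-constant (inj₂ max) y∈ z∈ =
  trans (≤⇒<ᵇ≡false (<⇒≤ (All.lookup max y∈))) (sym (≤⇒<ᵇ≡false (<⇒≤ (All.lookup max z∈))))

ascents-⊑ : ∀ {s σ} → s ⊑ σ → RightExtremal _<_ σ → ascents s ⊑ ascents σ
ascents-⊑ []                               _       = []
ascents-⊑ (_ ∷ʳ [])                        _       = []
ascents-⊑ {σ = _ ∷ _ ∷ _} (_ ∷ʳ s⊑σ)       (_ ∷ r) = _ ∷ʳ ascents-⊑ s⊑σ r
ascents-⊑ {s = _ ∷ []} (refl ∷ _)          _       = minimum _
ascents-⊑ {s = _ ∷ _ ∷ _} {_ ∷ _ ∷ _} (refl ∷ s⊑σ) (end ∷ r)
  rewrite RightEnd⇒<ᵇ-constant end (⊑-lookup s⊑σ (here refl)) (here refl) = refl ∷ ascents-⊑ s⊑σ r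

sublist-with-ascents : ∀ x σ {w} → RightExtremal _<_ (x ∷ σ) → w ⊑ ascents (x ∷ σ) →
  ∃[ s ] s ⊑ x ∷ σ × ascents s ≡ w × length s ≡ suc (length w)
sublist-with-ascents x []      _        []        = x ∷ [] , refl ∷ [] , refl , refl
sublist-with-ascents x (y ∷ σ) (_ ∷ r) (_ ∷ʳ w⊑) =
  let s , s⊑ , asc , len = sublist-with-ascents y σ r w⊑ in s , x ∷ʳ s⊑ , asc , len
sublist-with-ascents x (y ∷ σ) (end ∷ r) (refl ∷ w⊑)
  with y′ ∷ s , s⊑ , asc , len ← sublist-with-ascents y σ r w⊑
  rewrite RightEnd⇒<ᵇ-constant end (here {xs = σ} refl) (⊑-lookup s⊑ (here refl))
  = x ∷ y′ ∷ s , refl ∷ s⊑ , cong (_ ∷_) asc , cong suc len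

PairwiseAgree⇒ascents≡ : ∀ s t → length s ≡ length t → PairwiseAgree (zip s t) → ascents s ≡ ascents t
PairwiseAgree⇒ascents≡ []            []            _   _ = refl
PairwiseAgree⇒ascents≡ (_ ∷ [])      (_ ∷ [])      _   _ = refl
PairwiseAgree⇒ascents≡ (a ∷ a′ ∷ s) (b ∷ b′ ∷ t) len ((_ ∷ a≈b ∷ _) ∷ agree) =
  cong₂ _∷_ a≈b (PairwiseAgree⇒ascents≡ (a′ ∷ s) (b′ ∷ t) (suc-injective len) (All.map All.tail agree))

_⊏_ : ℕ × ℕ → ℕ × ℕ → Set
p ⊏ q = proj₁ p < proj₁ q × proj₂ p < proj₂ q

RightExtremal-⊏⇒PairwiseAgree : ∀ {z} → RightExtremal _⊏_ z → PairwiseAgree z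
RightExtremal-⊏⇒PairwiseAgree [] = []
RightExtremal-⊏⇒PairwiseAgree {(a , b) ∷ z} (end ∷ r) =
  (self ∷ row end) ∷
  All.zipWith (λ (q≈ab , agree) → q≈ab ∷ agree) (column end , RightExtremal-⊏⇒PairwiseAgree r)
  where
    self : Agree (a , b) (a , b)
    self rewrite n<ᵇn≡false a | n<ᵇn≡false b = refl
    row : RightEnd _⊏_ (a , b) z → All (Agree (a , b)) z
    both-true : ∀ {a b c d} → a < c → b < d → (a <ᵇ c) ≡ (b <ᵇ d)
    both-true a<c b<d = trans (<⇒<ᵇ≡true a<c) (sym (<⇒<ᵇ≡true b<d))
    both-false : ∀ {a b c d} → c < a → d < b → (a <ᵇ c) ≡ (b <ᵇ d)
    both-false c<a d<b = trans (≤⇒<ᵇ≡false (<⇒≤ c<a)) (sym (≤⇒<ᵇ≡false (<⇒≤ d<b)))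
    row (inj₁ above) = All.map (uncurry both-true) above
    row (inj₂ below) = All.map (uncurry both-false) below
    column : RightEnd _⊏_ (a , b) z → All (λ q → Agree q (a , b)) z
    column (inj₁ above) = All.map (uncurry both-false) above
    column (inj₂ below) = All.map (uncurry both-true) below

ascent⇒above : ∀ {a a′ s} → RightEnd _<_ a (a′ ∷ s) → (a <ᵇ a′) ≡ true → All (a <_) (a′ ∷ s)
ascent⇒above (inj₁ above)       _   = above
ascent⇒above (inj₂ (a′<a ∷ _)) asc = ⊥-elim (<-asym a′<a (<ᵇ≡true⇒< asc))

descent⇒below : ∀ {a a′ s} → RightEnd _<_ a (a′ ∷ s) → (a <ᵇ a′) ≡ false → All (_< a) (a′ ∷ s)
descent⇒below (inj₂ below)       _    = below
descent⇒below (inj₁ (a<a′ ∷ _)) desc with () ← trans (sym (<⇒<ᵇ≡true a<a′)) desc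

ascents≡⇒RightExtremal-zip : ∀ s t → RightExtremal _<_ s → RightExtremal _<_ t →
  length s ≡ length t → ascents s ≡ ascents t → RightExtremal _⊏_ (zip s t)
ascents≡⇒RightExtremal-zip []            []            _ _ _ _ = []
ascents≡⇒RightExtremal-zip (_ ∷ [])      (_ ∷ [])      _ _ _ _ = inj₁ [] ∷ []
ascents≡⇒RightExtremal-zip (a ∷ a′ ∷ s) (b ∷ b′ ∷ t) (ea ∷ rs) (eb ∷ rt) len asc
  with a <ᵇ a′ in ab | b <ᵇ b′ in bb | ∷-injectiveˡ asc
... | true  | true  | _ = inj₁ (All-zip (ascent⇒above ea ab) (ascent⇒above eb bb)) ∷ rest
  where rest = ascents≡⇒RightExtremal-zip (a′ ∷ s) (b′ ∷ t) rs rt (suc-injective len) (∷-injectiveʳ asc)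
... | false | false | _ = inj₂ (All-zip (descent⇒below ea ab) (descent⇒below eb bb)) ∷ rest
  where rest = ascents≡⇒RightExtremal-zip (a′ ∷ s) (b′ ∷ t) rs rt (suc-injective len) (∷-injectiveʳ asc)

¬ascents-⊑⇒avoids : ∀ {σ τ} → RightExtremal _<_ σ → ¬ (ascents τ ⊑ ascents σ) → avoids σ τ ≡ true
¬ascents-⊑⇒avoids {σ} {τ} r ¬asc⊑ = avoids⁺ λ {s} s⊑σ iso →
  let len , agree = orderIso⁻ s τ iso
  in ¬asc⊑ (subst (_⊑ ascents σ) (PairwiseAgree⇒ascents≡ s τ len agree) (ascents-⊑ s⊑σ r))

avoids⇒¬ascents-⊑ : ∀ {x σ t τ} → RightExtremal _<_ (x ∷ σ) → RightExtremal _<_ (t ∷ τ) →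
  avoids (x ∷ σ) (t ∷ τ) ≡ true → ¬ (ascents (t ∷ τ) ⊑ ascents (x ∷ σ))
avoids⇒¬ascents-⊑ {x} {σ} {t} {τ} rσ rτ av asc⊑ =
  let s , s⊑ , asc , len = sublist-with-ascents x σ rσ asc⊑
      len′ = trans len (cong suc (length-ascents t τ))
      rs = RightExtremal-⊑ _<_ s⊑ rσ
  in avoids⁻ av s⊑ (orderIso⁺ s (t ∷ τ) len′
       (RightExtremal-⊏⇒PairwiseAgree (ascents≡⇒RightExtremal-zip s (t ∷ τ) rs rτ len′ asc)))

fromAscents : ℕ → List Bool → List ℕ
fromAscents lo []          = lo ∷ []
fromAscents lo (true ∷ u)  = lo ∷ fromAscents (suc lo) u
fromAscents lo (false ∷ u) = lo + suc (length u) ∷ fromAscents lo u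

length-fromAscents : ∀ lo u → length (fromAscents lo u) ≡ suc (length u)
length-fromAscents lo []          = refl
length-fromAscents lo (true ∷ u)  = cong suc (length-fromAscents (suc lo) u)
length-fromAscents lo (false ∷ u) = cong suc (length-fromAscents lo u)

fromAscents-bounds : ∀ lo u → All (λ v → lo ≤ v × v ≤ lo + length u) (fromAscents lo u)
fromAscents-bounds lo []          = (≤-refl , m≤m+n lo 0) ∷ []
fromAscents-bounds lo (true ∷ u)  =
  (≤-refl , m≤m+n lo _) ∷
  All.map (λ {v} (lo< , ≤top) → <⇒≤ lo< , subst (v ≤_) (sym (+-suc lo (length u))) ≤top)
          (fromAscents-bounds (suc lo) u)
fromAscents-bounds lo (false ∷ u) =
  (m≤m+n lo _ , ≤-refl) ∷
  All.map (λ (lo≤ , ≤top) → lo≤ , <⇒≤ (≤⇒<+suc lo _ ≤top)) (fromAscents-bounds lo u)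

above-tail : ∀ lo u → All (lo <_) (fromAscents (suc lo) u)
above-tail lo u = All.map proj₁ (fromAscents-bounds (suc lo) u)

below-head : ∀ lo u → All (_< lo + suc (length u)) (fromAscents lo u)
below-head lo u = All.map (≤⇒<+suc lo _ ∘ proj₂) (fromAscents-bounds lo u)

∈-fromAscents⁺ : ∀ lo u {v} → lo ≤ v → v ≤ lo + length u → v ∈ fromAscents lo u
∈-fromAscents⁺ lo []          {v} lo≤v v≤ = here (≤-antisym (subst (v ≤_) (+-identityʳ lo) v≤) lo≤v)
∈-fromAscents⁺ lo (true ∷ u)  {v} lo≤v v≤ with v ≟ lo
... | yes refl = here refl
... | no v≢lo  =
  there (∈-fromAscents⁺ (suc lo) u (≤∧≢⇒< lo≤v (v≢lo ∘ sym)) (subst (v ≤_) (+-suc lo _) v≤))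
∈-fromAscents⁺ lo (false ∷ u) {v} lo≤v v≤ with v ≟ lo + suc (length u)
... | yes refl = here refl
... | no v≢top =
  there (∈-fromAscents⁺ lo u lo≤v (≤-pred (subst (v <_) (+-suc lo _) (≤∧≢⇒< v≤ v≢top))))

RightExtremal-fromAscents : ∀ lo u → RightExtremal _<_ (fromAscents lo u)
RightExtremal-fromAscents lo []          = inj₁ [] ∷ []
RightExtremal-fromAscents lo (true ∷ u)  = inj₁ (above-tail lo u) ∷ RightExtremal-fromAscents (suc lo) u
RightExtremal-fromAscents lo (false ∷ u) = inj₂ (below-head lo u) ∷ RightExtremal-fromAscents lo u

ascents-∷-above : ∀ {x ys} → All (x <_) ys → 0 < length ys → ascents (x ∷ ys) ≡ true ∷ ascents ys
ascents-∷-above (x<y ∷ _) _ rewrite <⇒<ᵇ≡true x<y = refl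

ascents-∷-below : ∀ {x ys} → All (_< x) ys → 0 < length ys → ascents (x ∷ ys) ≡ false ∷ ascents ys
ascents-∷-below (y<x ∷ _) _ rewrite ≤⇒<ᵇ≡false (<⇒≤ y<x) = refl

0<length-fromAscents : ∀ lo u → 0 < length (fromAscents lo u)
0<length-fromAscents lo u = subst (0 <_) (sym (length-fromAscents lo u)) z<s

ascents-fromAscents : ∀ lo u → ascents (fromAscents lo u) ≡ u
ascents-fromAscents lo []          = refl
ascents-fromAscents lo (true ∷ u)  =
  trans (ascents-∷-above (above-tail lo u) (0<length-fromAscents (suc lo) u))
        (cong (true ∷_) (ascents-fromAscents (suc lo) u))
ascents-fromAscents lo (false ∷ u) =
  trans (ascents-∷-below (below-head lo u) (0<length-fromAscents lo u))
        (cong (false ∷_) (ascents-fromAscents lo u))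

fromAscents-injective : ∀ {lo u u′} → fromAscents lo u ≡ fromAscents lo u′ → u ≡ u′
fromAscents-injective {lo} {u} {u′} eq =
  trans (sym (ascents-fromAscents lo u)) (trans (cong ascents eq) (ascents-fromAscents lo u′))

record Enumerates (lo L : ℕ) (z : List ℕ) : Set where
  field
    bounded  : All (λ v → lo ≤ v × v ≤ lo + L) z
    complete : ∀ {v} → lo ≤ v → v ≤ lo + L → v ∈ z

Enumerates-fromAscents : ∀ lo u → Enumerates lo (length u) (fromAscents lo u)
Enumerates-fromAscents lo u = record { bounded = fromAscents-bounds lo u ; complete = ∈-fromAscents⁺ lo u }

module _ {x z lo L} (e : Enumerates lo (suc L) (x ∷ z)) where
  open Enumerates e

  minimal-head : All (x <_) z → x ≡ lo × Enumerates (suc lo) L z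
  minimal-head above = x≡lo , record
    { bounded  = All.zipWith (λ {v} (x<v , _ , v≤) → subst (_< v) x≡lo x<v , subst (v ≤_) (+-suc lo L) v≤)
                             (above , All.tail bounded)
    ; complete = λ {v} lo<v v≤ → in-tail lo<v (complete (<⇒≤ lo<v) (subst (v ≤_) (sym (+-suc lo L)) v≤)) }
    where
      x≡lo : x ≡ lo
      x≡lo with complete ≤-refl (m≤m+n lo _)
      ... | here lo≡x  = sym lo≡x
      ... | there lo∈z = ⊥-elim (<-irrefl refl (<-≤-trans (All.lookup above lo∈z) (proj₁ (All.head bounded))))
      in-tail : ∀ {v} → lo < v → v ∈ x ∷ z → v ∈ z
      in-tail lo<v (here refl) = ⊥-elim (<-irrefl (sym x≡lo) lo<v)
      in-tail _    (there v∈z) = v∈z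

  maximal-head : All (_< x) z → x ≡ lo + suc L × Enumerates lo L z
  maximal-head below = x≡top , record
    { bounded  = All.zipWith (λ {v} (v<x , lo≤v , _) →
                                lo≤v , ≤-pred (subst (v <_) (trans x≡top (+-suc lo L)) v<x))
                             (below , All.tail bounded)
    ; complete = λ {v} lo≤v v≤ → in-tail v≤ (complete lo≤v (≤-trans v≤ (+-monoʳ-≤ lo (n≤1+n L)))) }
    where
      x≡top : x ≡ lo + suc L
      x≡top with complete (m≤m+n lo _) ≤-refl
      ... | here top≡x  = sym top≡x
      ... | there top∈z = ⊥-elim (<-irrefl refl (<-≤-trans (All.lookup below top∈z) (proj₂ (All.head bounded))))
      in-tail : ∀ {v} → v ≤ lo + L → v ∈ x ∷ z → v ∈ z
      in-tail v≤ (here refl) =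
        ⊥-elim (<-irrefl refl (≤-<-trans v≤ (subst (lo + L <_) (sym x≡top) (≤⇒<+suc lo L ≤-refl))))
      in-tail _  (there v∈z) = v∈z

RightExtremal-Enumerates⇒≡fromAscents : ∀ {z lo L} → RightExtremal _<_ z → Enumerates lo L z →
  length z ≡ suc L → z ≡ fromAscents lo (ascents z)
RightExtremal-Enumerates⇒≡fromAscents {x ∷ []} {lo} {zero} _ e _
  with here refl ← Enumerates.complete e ≤-refl (m≤m+n lo 0) = refl
RightExtremal-Enumerates⇒≡fromAscents {x ∷ y ∷ z} {lo} {suc L} (inj₁ above ∷ r) e len
  with refl , e′ ← minimal-head e above
  rewrite <⇒<ᵇ≡true (All.head above) =
  cong (x ∷_) (RightExtremal-Enumerates⇒≡fromAscents r e′ (suc-injective len))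
RightExtremal-Enumerates⇒≡fromAscents {x ∷ y ∷ z} {lo} {suc L} (inj₂ below ∷ r) e len
  with x≡top , e′ ← maximal-head e below
  rewrite ≤⇒<ᵇ≡false (<⇒≤ (All.head below)) =
  cong₂ _∷_ (trans x≡top (cong (λ n → lo + suc n) L≡))
            (RightExtremal-Enumerates⇒≡fromAscents r e′ (suc-injective len))
  where L≡ : L ≡ length (ascents (y ∷ z))
        L≡ = sym (trans (length-ascents y z) (suc-injective (suc-injective len)))

-- Counting the avoiders

bitWords : ℕ → List (List Bool)
bitWords = wordsOver (true ∷ false ∷ [])

Unique-bitWords : ∀ m → Unique (bitWords m)
Unique-bitWords m = Unique-wordsOver m (((λ ()) ∷ []) ∷ [] ∷ [])

bool∈ : ∀ b → b ∈ true ∷ false ∷ []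
bool∈ true  = here refl
bool∈ false = there (here refl)

-- binomialSum m j = Σ_{i<j} (m choose i)
binomialSum : ℕ → ℕ → ℕ
binomialSum m       zero    = 0
binomialSum zero    (suc j) = 1
binomialSum (suc m) (suc j) = binomialSum m j + binomialSum m (suc j)

infix 4 _⋢_ _⋢?_

_⋢_ : List Bool → List Bool → Set
w ⋢ u = ¬ (w ⊑ u)

_⋢?_ : ∀ w → Decidable (w ⋢_)
w ⋢? u = ¬? (w ⊑? u)

length-filter-bitWords : ∀ {P : List Bool → Set} (P? : Decidable P) m →
  length (filter P? (bitWords (suc m))) ≡
  length (filter (P? ∘ (true ∷_)) (bitWords m)) + length (filter (P? ∘ (false ∷_)) (bitWords m))
length-filter-bitWords P? m = begin
  length (filter P? (map (true ∷_) W ++ map (false ∷_) W ++ []))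
    ≡⟨ cong (λ ws → length (filter P? (map (true ∷_) W ++ ws))) (++-identityʳ _) ⟩
  length (filter P? (map (true ∷_) W ++ map (false ∷_) W))
    ≡⟨ cong length (filter-++ P? (map (true ∷_) W) _) ⟩
  length (filter P? (map (true ∷_) W) ++ filter P? (map (false ∷_) W))
    ≡⟨ length-++ (filter P? (map (true ∷_) W)) ⟩
  length (filter P? (map (true ∷_) W)) + length (filter P? (map (false ∷_) W))
    ≡⟨ cong₂ _+_ (length-filter-map P? (true ∷_) W) (length-filter-map P? (false ∷_) W) ⟩
  length (filter (P? ∘ (true ∷_)) W) + length (filter (P? ∘ (false ∷_)) W) ∎
  where
    open ≡-Reasoning
    W = bitWords m

filter-⋢-same-letter : ∀ b w us → filter ((b ∷ w ⋢?_) ∘ (b ∷_)) us ≡ filter (w ⋢?_) us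
filter-⋢-same-letter b w = filter-≐ ((b ∷ w ⋢?_) ∘ (b ∷_)) (w ⋢?_) (¬-≐ (∷⁻¹ refl))

filter-⋢-other-letter : ∀ {b c} w us → b ≢ c →
  filter ((b ∷ w ⋢?_) ∘ (c ∷_)) us ≡ filter (b ∷ w ⋢?_) us
filter-⋢-other-letter {b} {c} w us b≢c =
  filter-≐ ((b ∷ w ⋢?_) ∘ (c ∷_)) (b ∷ w ⋢?_) (¬-≐ (∷ʳ⁻¹ b≢c)) us

length-filter-⋢ : ∀ m w → length (filter (w ⋢?_) (bitWords m)) ≡ binomialSum m (length w)
length-filter-⋢ m       []      =
  cong length (filter-none ([] ⋢?_) {bitWords m} (All.universal (λ _ ¬[]⊑ → ¬[]⊑ (minimum _)) _))
length-filter-⋢ zero    (b ∷ w) = cong length (filter-accept (b ∷ w ⋢?_) {[]} {[]} λ ())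
length-filter-⋢ (suc m) (true ∷ w) = begin
  length (filter P? (bitWords (suc m)))
    ≡⟨ length-filter-bitWords P? m ⟩
  length (filter (P? ∘ (true ∷_)) W) + length (filter (P? ∘ (false ∷_)) W)
    ≡⟨ cong₂ _+_ (cong length (filter-⋢-same-letter true w W)) (cong length (filter-⋢-other-letter w W λ ())) ⟩
  length (filter (w ⋢?_) W) + length (filter P? W)
    ≡⟨ cong₂ _+_ (length-filter-⋢ m w) (length-filter-⋢ m (true ∷ w)) ⟩
  binomialSum (suc m) (suc (length w)) ∎
  where
    open ≡-Reasoning
    W = bitWords m
    P? = true ∷ w ⋢?_
length-filter-⋢ (suc m) (false ∷ w) = begin
  length (filter P? (bitWords (suc m)))
    ≡⟨ length-filter-bitWords P? m ⟩
  length (filter (P? ∘ (true ∷_)) W) + length (filter (P? ∘ (false ∷_)) W)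
    ≡⟨ cong₂ _+_ (cong length (filter-⋢-other-letter w W λ ())) (cong length (filter-⋢-same-letter false w W)) ⟩
  length (filter P? W) + length (filter (w ⋢?_) W)
    ≡⟨ cong₂ _+_ (length-filter-⋢ m (false ∷ w)) (length-filter-⋢ m w) ⟩
  binomialSum m (suc (length w)) + binomialSum m (length w)
    ≡⟨ +-comm (binomialSum m (suc (length w))) _ ⟩
  binomialSum (suc m) (suc (length w)) ∎
  where
    open ≡-Reasoning
    W = bitWords m
    P? = false ∷ w ⋢?_

words≡wordsOver : ∀ n m → words n m ≡ wordsOver (applyUpTo suc n) m
words≡wordsOver n zero    = refl
words≡wordsOver n (suc m) = cong (λ W → concatMap (λ v → map (v ∷_) W) (applyUpTo suc n)) (words≡wordsOver n m)

∈-upTo⁻ : ∀ {n v} → v ∈ applyUpTo suc n → 1 ≤ v × v ≤ n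
∈-upTo⁻ v∈ with _ , i<n , refl ← ∈-applyUpTo⁻ suc v∈ = s≤s z≤n , i<n

∈-upTo⁺ : ∀ {n v} → 1 ≤ v → v ≤ n → v ∈ applyUpTo suc n
∈-upTo⁺ {v = suc i} _ i<n = ∈-applyUpTo⁺ suc i<n

Unique-upTo : ∀ n → Unique (applyUpTo suc n)
Unique-upTo n = Unique.applyUpTo⁺₁ suc n (λ i<j _ → <⇒≢ (s≤s i<j))

isPerm⁻ : ∀ n w → isPerm n w ≡ true → length w ≡ n × applyUpTo suc n ⊆ w
isPerm⁻ n w perm =
  ≡ᵇ⇒≡ _ _ (Equivalence.from T-≡ (∧-conicalˡ _ _ perm)) ,
  λ {v} v∈ → let _ , v′∈w , v≡v′ = anyB⇒∃ (v ≡ᵇ_) w (All.lookup (allB⇒All _ _ (∧-conicalʳ _ _ perm)) v∈)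
             in subst (_∈ w) (sym (≡ᵇ⇒≡ _ _ (Equivalence.from T-≡ v≡v′))) v′∈w

isPerm⁺ : ∀ n w → length w ≡ n → applyUpTo suc n ⊆ w → isPerm n w ≡ true
isPerm⁺ n w len cover rewrite Equivalence.to T-≡ (≡⇒≡ᵇ (length w) n len) =
  All⇒allB _ (All.tabulate λ {v} v∈ →
    ∈⇒anyB (v ≡ᵇ_) (cover v∈) (Equivalence.to T-≡ (≡⇒≡ᵇ v v refl)))

isPerm⇒Unique : ∀ n σ → isPerm n σ ≡ true → Unique σ
isPerm⇒Unique n σ perm =
  covers-Unique⇒Unique _≟_ (Unique-upTo n) cover (≤-reflexive (trans len (sym (length-applyUpTo suc n))))
  where len = proj₁ (isPerm⁻ n σ perm)
        cover = proj₂ (isPerm⁻ n σ perm)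

module _ (m : ℕ) where
  private n = suc m

  ∈-Sn⁻ : ∀ {σ} → σ ∈ Sn n → length σ ≡ n × Unique σ × Enumerates 1 m σ
  ∈-Sn⁻ {σ} σ∈ = len , unique , record
    { bounded  = All.map ∈-upTo⁻ (proj₂ (∈-wordsOver⁻ _ n (subst (σ ∈_) (words≡wordsOver n n) σ∈words)))
    ; complete = λ 1≤v v≤ → cover (∈-upTo⁺ 1≤v v≤) }
    where
      σ∈words = proj₁ (∈-filterB⁻ (isPerm n) (words n n) σ∈)
      perm    = isPerm⁻ n σ (proj₂ (∈-filterB⁻ (isPerm n) (words n n) σ∈))
      len     = proj₁ perm
      cover   = proj₂ perm
      unique  = isPerm⇒Unique n σ (proj₂ (∈-filterB⁻ (isPerm n) (words n n) σ∈))

  ∈-Sn⁺ : ∀ {σ} → length σ ≡ n → Enumerates 1 m σ → σ ∈ Sn n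
  ∈-Sn⁺ {σ} len e =
    ∈-filterB⁺ (isPerm n) σ∈words (isPerm⁺ n σ len λ v∈ → uncurry complete (∈-upTo⁻ v∈))
    where
      open Enumerates e
      σ∈words = subst (σ ∈_) (sym (words≡wordsOver n n))
                  (∈-wordsOver⁺ _ n len (All.map (uncurry ∈-upTo⁺) bounded))

Unique-Sn : ∀ n → Unique (Sn n)
Unique-Sn n =
  Unique-filterB (isPerm n) (subst Unique (sym (words≡wordsOver n n)) (Unique-wordsOver n (Unique-upTo n)))

forbidden : List ℕ → List (List ℕ)
forbidden τ = (2 ∷ 1 ∷ 3 ∷ []) ∷ (2 ∷ 3 ∷ 1 ∷ []) ∷ τ ∷ []

module _ (m : ℕ) {t τ} (rτ : RightExtremal _<_ (t ∷ τ)) where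
  private
    βs : List (List ℕ)
    βs = forbidden (t ∷ τ)
    avoidsAll : List ℕ → Bool
    avoidsAll σ = allB (avoids σ) βs
    Avoiders Encodings : List (List ℕ)
    Avoiders  = filterB avoidsAll (Sn (suc m))
    Encodings = map (fromAscents 1) (filter (ascents (t ∷ τ) ⋢?_) (bitWords m))

  Avoiders⊆Encodings : Avoiders ⊆ Encodings
  Avoiders⊆Encodings {[]} σ∈ with () ← proj₁ (∈-Sn⁻ m (proj₁ (∈-filterB⁻ avoidsAll (Sn (suc m)) σ∈)))
  Avoiders⊆Encodings {σ@(x ∷ σ′)} σ∈
    with σ∈Sn , av ← ∈-filterB⁻ avoidsAll (Sn (suc m)) σ∈
    with av-213 ∷ av-231 ∷ av-τ ∷ [] ← allB⇒All (avoids σ) βs av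
    with len , unique , e ← ∈-Sn⁻ m σ∈Sn =
    subst (_∈ Encodings) (sym σ≡)
      (∈-map⁺ (fromAscents 1) (∈-filter⁺ (_ ⋢?_) ascents∈ (avoids⇒¬ascents-⊑ r rτ av-τ)))
    where
      r  = avoids⇒RightExtremal unique av-213 av-231
      σ≡ = RightExtremal-Enumerates⇒≡fromAscents r e len
      ascents∈ : ascents σ ∈ bitWords m
      ascents∈ = ∈-wordsOver⁺ _ m (trans (length-ascents x σ′) (suc-injective len)) (All.universal bool∈ _)

  Encodings⊆Avoiders : Encodings ⊆ Avoiders
  Encodings⊆Avoiders z∈
    with u , u∈ , refl ← ∈-map⁻ (fromAscents 1) z∈
    with u∈W , ¬asc⊑u ← ∈-filter⁻ (_ ⋢?_) {xs = bitWords m} u∈ =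
    ∈-filterB⁺ avoidsAll (∈-Sn⁺ m len e)
      (All⇒allB (avoids z) (RightExtremal⇒avoids-213 r ∷ RightExtremal⇒avoids-231 r ∷ av-τ ∷ []))
    where
      z  = fromAscents 1 u
      r  = RightExtremal-fromAscents 1 u
      length-u = proj₁ (∈-wordsOver⁻ _ m u∈W)
      len = trans (length-fromAscents 1 u) (cong suc length-u)
      e   = subst (λ L → Enumerates 1 L z) length-u (Enumerates-fromAscents 1 u)
      av-τ = ¬ascents-⊑⇒avoids r
               (subst (λ w → ¬ (ascents (t ∷ τ) ⊑ w)) (sym (ascents-fromAscents 1 u)) ¬asc⊑u)

  countAvoiders≡binomialSum : countAvoiders (suc m) (forbidden (t ∷ τ)) ≡ binomialSum m (length τ)
  countAvoiders≡binomialSum = begin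
    length Avoiders
      ≡⟨ Unique-⊆-⊇⇒length≡ unique-avoiders unique-encodings Avoiders⊆Encodings Encodings⊆Avoiders ⟩
    length Encodings
      ≡⟨ length-map (fromAscents 1) (filter (ascents (t ∷ τ) ⋢?_) (bitWords m)) ⟩
    length (filter (ascents (t ∷ τ) ⋢?_) (bitWords m))
      ≡⟨ length-filter-⋢ m (ascents (t ∷ τ)) ⟩
    binomialSum m (length (ascents (t ∷ τ)))
      ≡⟨ cong (binomialSum m) (length-ascents t τ) ⟩
    binomialSum m (length τ) ∎
    where
      open ≡-Reasoning
      unique-avoiders = Unique-filterB avoidsAll (Unique-Sn (suc m))
      unique-encodings = Unique.map⁺ fromAscents-injective (Unique.filter⁺ (_ ⋢?_) (Unique-bitWords m))

-- The determinant

≈-refl : ∀ {f} → f ≈PS f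
≈-refl _ = refl

≈-trans : ∀ {f g h} → f ≈PS g → g ≈PS h → f ≈PS h
≈-trans f≈g g≈h n = trans (f≈g n) (g≈h n)

⊕-cong : ∀ {f f′ g g′} → f ≈PS f′ → g ≈PS g′ → (f ⊕ g) ≈PS (f′ ⊕ g′)
⊕-cong f≈ g≈ n = cong₂ _+ℤ_ (f≈ n) (g≈ n)

scale-cong : ∀ c {f g} → f ≈PS g → scalePS c f ≈PS scalePS c g
scale-cong c f≈g n = cong (c *ℤ_) (f≈g n)

⊛-cong : ∀ {f f′ g g′} → f ≈PS f′ → g ≈PS g′ → (f ⊛ g) ≈PS (f′ ⊛ g′)
⊛-cong {f} {f′} {g} {g′} f≈ g≈ n = convSum-cong n
  where
    convSum-cong : ∀ j → convSum f g n j ≡ convSum f′ g′ n j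
    convSum-cong zero    = cong₂ _*ℤ_ (f≈ 0) (g≈ n)
    convSum-cong (suc j) = cong₂ _+ℤ_ (cong₂ _*ℤ_ (f≈ (suc j)) (g≈ (n ∸ suc j))) (convSum-cong j)

sumPS-cong : ∀ n {f g : Fin n → PS} → (∀ j → f j ≈PS g j) → sumPS n f ≈PS sumPS n g
sumPS-cong zero    _   = ≈-refl
sumPS-cong (suc n) f≈g = ⊕-cong (f≈g Fin.zero) (sumPS-cong n (f≈g ∘ Fin.suc))

sumPS-zero : ∀ n {f : Fin n → PS} → (∀ j → f j ≈PS zeroPS) → sumPS n f ≈PS zeroPS
sumPS-zero zero    _     = ≈-refl
sumPS-zero (suc n) f≈0 k = cong₂ _+ℤ_ (f≈0 Fin.zero k) (sumPS-zero n (f≈0 ∘ Fin.suc) k)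

⊛-zeroˡ : ∀ {f} g → f ≈PS zeroPS → (f ⊛ g) ≈PS zeroPS
⊛-zeroˡ {f} g f≈0 n = convSum-zero n
  where
    convSum-zero : ∀ j → convSum f g n j ≡ + 0
    convSum-zero zero    rewrite f≈0 0 = refl
    convSum-zero (suc j) rewrite f≈0 (suc j) | convSum-zero j = refl

⊛-zeroʳ : ∀ f {g} → g ≈PS zeroPS → (f ⊛ g) ≈PS zeroPS
⊛-zeroʳ f {g} g≈0 n = convSum-zero n
  where
    convSum-zero : ∀ j → convSum f g n j ≡ + 0
    convSum-zero zero    rewrite g≈0 n = ℤ.*-zeroʳ (f 0)
    convSum-zero (suc j) rewrite g≈0 (n ∸ suc j) | ℤ.*-zeroʳ (f (suc j)) | convSum-zero j = refl

⊛-identityˡ : ∀ g → (onePS ⊛ g) ≈PS g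
⊛-identityˡ g n = convSum-one n
  where
    convSum-one : ∀ j → convSum onePS g n j ≡ g n
    convSum-one zero    = ℤ.*-identityˡ (g n)
    convSum-one (suc j) = trans (ℤ.+-identityˡ _) (convSum-one j)

negPS-⊛ : ∀ f g → (negPS f ⊛ g) ≈PS negPS (f ⊛ g)
negPS-⊛ f g n = convSum-neg n
  where
    convSum-neg : ∀ j → convSum (negPS f) g n j ≡ - convSum f g n j
    convSum-neg zero    = sym (ℤ.neg-distribˡ-* (f 0) (g n))
    convSum-neg (suc j) =
      trans (cong₂ _+ℤ_ (sym (ℤ.neg-distribˡ-* (f (suc j)) (g (n ∸ suc j)))) (convSum-neg j))
            (sym (ℤ.neg-distrib-+ (f (suc j) *ℤ g (n ∸ suc j)) (convSum f g n j)))

scale-zero : ∀ c {f} → f ≈PS zeroPS → scalePS c f ≈PS zeroPS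
scale-zero c f≈0 n rewrite f≈0 n = ℤ.*-zeroʳ c

scale-one : ∀ f → scalePS (+ 1) f ≈PS f
scale-one f n = ℤ.*-identityˡ (f n)

scale-minus-one-neg : ∀ f → scalePS (sgn 1) (negPS f) ≈PS f
scale-minus-one-neg f n = trans (ℤ.-1*i≡-i _) (ℤ.neg-involutive (f n))

minor : ∀ {n} → (Fin (suc n) → Fin (suc n) → PS) → Fin (suc n) → Fin n → Fin n → PS
minor M j a b = M (Fin.suc a) (punchIn j b)

det-cong : ∀ n {M N : Fin n → Fin n → PS} → (∀ a b → M a b ≈PS N a b) → det n M ≈PS det n N
det-cong zero    _   = ≈-refl
det-cong (suc n) M≈N = sumPS-cong (suc n) λ j →
  scale-cong (sgn (toℕ j)) (⊛-cong (M≈N Fin.zero j) (det-cong n λ a b → M≈N (Fin.suc a) (punchIn j b)))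

det-zero-column : ∀ n (M : Fin (suc n) → Fin (suc n) → PS) → (∀ a → M a Fin.zero ≈PS zeroPS) →
  det (suc n) M ≈PS zeroPS
det-zero-column n M column≈0 = sumPS-zero (suc n) term
  where
    term : ∀ j → scalePS (sgn (toℕ j)) (M Fin.zero j ⊛ det n (minor M j)) ≈PS zeroPS
    term Fin.zero = scale-zero (+ 1) (⊛-zeroˡ (det n (minor M Fin.zero)) (column≈0 Fin.zero))
    term (Fin.suc {suc n′} j) =
      scale-zero (sgn (suc (toℕ j)))
        (⊛-zeroʳ (M Fin.zero (Fin.suc j)) (det-zero-column n′ (minor M (Fin.suc j)) (column≈0 ∘ Fin.suc)))

bidiagonal : ℕ → ℕ → PS
bidiagonal i j = if i ≡ᵇ j then onePS else if j ≡ᵇ suc i then negPS gPS else zeroPS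

det-bidiagonal : ∀ n → det n (λ a b → bidiagonal (toℕ a) (toℕ b)) ≈PS onePS
det-bidiagonal zero    = ≈-refl
det-bidiagonal (suc n) =
  ≈-trans (⊕-cong first (sumPS-zero n rest)) (λ k → ℤ.+-identityʳ (onePS k))
  where
    B = λ a b → bidiagonal (toℕ a) (toℕ b)
    first : scalePS (+ 1) (onePS ⊛ det n (minor B Fin.zero)) ≈PS onePS
    first = ≈-trans (scale-one _) (≈-trans (⊛-identityˡ _) (det-bidiagonal n))
    rest : ∀ j → scalePS (sgn (toℕ (Fin.suc j))) (B Fin.zero (Fin.suc j) ⊛ det n (minor B (Fin.suc j))) ≈PS zeroPS
    rest Fin.zero = -- the minor of the second column has a zero first column
      scale-zero (sgn 1)
        (⊛-zeroʳ (B Fin.zero (Fin.suc Fin.zero)) (det-zero-column _ (minor B (Fin.suc Fin.zero)) λ _ → ≈-refl))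
    rest (Fin.suc j) = scale-zero (sgn (suc (suc (toℕ j)))) (⊛-zeroˡ (det n (minor B (Fin.suc (Fin.suc j)))) ≈-refl)

geometricPS : ℕ → PS
geometricPS zero    = onePS
geometricPS (suc k) = onePS ⊕ (gPS ⊛ geometricPS k)

det-Mτ : ∀ k → det (suc k) (Mτ (suc k)) ≈PS geometricPS k
det-Mτ zero    = ≈-trans (λ n → ℤ.+-identityʳ _) (≈-trans (scale-one _) (⊛-identityˡ onePS))
det-Mτ (suc k) = ⊕-cong first (≈-trans (⊕-cong second (sumPS-zero k rest)) (λ n → ℤ.+-identityʳ _))
  where
    M = Mτ (suc (suc k))
    first : scalePS (+ 1) (onePS ⊛ det (suc k) (minor M Fin.zero)) ≈PS onePS
    first = ≈-trans (scale-one _) (≈-trans (⊛-identityˡ _)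
              (≈-trans (det-cong (suc k) {N = λ a b → bidiagonal (toℕ a) (toℕ b)} (λ _ _ → ≈-refl))
                       (det-bidiagonal (suc k))))
    minor-second : ∀ a b → minor M (Fin.suc Fin.zero) a b ≈PS Mτ (suc k) a b
    minor-second a Fin.zero    = ≈-refl
    minor-second a (Fin.suc b) = ≈-refl
    second : scalePS (sgn 1) (negPS gPS ⊛ det (suc k) (minor M (Fin.suc Fin.zero))) ≈PS (gPS ⊛ geometricPS k)
    second = ≈-trans (scale-cong (sgn 1) (negPS-⊛ gPS _))
               (≈-trans (scale-minus-one-neg _)
                        (⊛-cong ≈-refl (≈-trans (det-cong (suc k) minor-second) (det-Mτ k))))
    rest : ∀ j → scalePS (sgn (toℕ (Fin.suc (Fin.suc j)))) (M Fin.zero (Fin.suc (Fin.suc j)) ⊛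
                   det (suc k) (minor M (Fin.suc (Fin.suc j)))) ≈PS zeroPS
    rest j = scale-zero (sgn (suc (suc (toℕ j)))) (⊛-zeroˡ (det (suc k) (minor M (Fin.suc (Fin.suc j)))) ≈-refl)

sumBelow : (ℕ → ℤ) → ℕ → ℤ
sumBelow h zero    = + 0
sumBelow h (suc n) = h n +ℤ sumBelow h n

sumBelow-suc : ∀ h n → sumBelow h (suc n) ≡ h 0 +ℤ sumBelow (h ∘ suc) n
sumBelow-suc h zero    = refl
sumBelow-suc h (suc n) = begin
  h (suc n) +ℤ sumBelow h (suc n)               ≡⟨ cong (h (suc n) +ℤ_) (sumBelow-suc h n) ⟩
  h (suc n) +ℤ (h 0 +ℤ sumBelow (h ∘ suc) n)    ≡⟨ ℤ.+-assoc (h (suc n)) (h 0) _ ⟨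
  h (suc n) +ℤ h 0 +ℤ sumBelow (h ∘ suc) n      ≡⟨ cong (_+ℤ sumBelow (h ∘ suc) n) (ℤ.+-comm (h (suc n)) (h 0)) ⟩
  h 0 +ℤ h (suc n) +ℤ sumBelow (h ∘ suc) n      ≡⟨ ℤ.+-assoc (h 0) (h (suc n)) _ ⟩
  h 0 +ℤ sumBelow (h ∘ suc) (suc n)             ∎
  where open ≡-Reasoning

gPS-⊛ : ∀ f n → (gPS ⊛ f) n ≡ sumBelow (λ i → f (n ∸ suc i)) n
gPS-⊛ f n = convSum-g n
  where
    convSum-g : ∀ j → convSum gPS f n j ≡ sumBelow (λ i → f (n ∸ suc i)) j
    convSum-g zero    = refl
    convSum-g (suc j) = cong₂ _+ℤ_ (ℤ.*-identityˡ (f (n ∸ suc j))) (convSum-g j)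

geometricPS-zero : ∀ k → geometricPS k 0 ≡ + 1
geometricPS-zero zero    = refl
geometricPS-zero (suc k) = refl

mutual
  geometricPS-suc : ∀ k m → geometricPS k (suc m) ≡ + binomialSum m k
  geometricPS-suc zero    m = refl
  geometricPS-suc (suc k) m =
    trans (ℤ.+-identityˡ _) (trans (gPS-⊛ (geometricPS k) (suc m)) (sumBelow-geometricPS k m))

  sumBelow-geometricPS : ∀ k m → sumBelow (λ i → geometricPS k (m ∸ i)) (suc m) ≡ + binomialSum m (suc k)
  sumBelow-geometricPS k zero    rewrite geometricPS-zero k = refl
  sumBelow-geometricPS k (suc m) = begin
    sumBelow (λ i → geometricPS k (suc m ∸ i)) (suc (suc m))
      ≡⟨ sumBelow-suc (λ i → geometricPS k (suc m ∸ i)) (suc m) ⟩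
    geometricPS k (suc m) +ℤ sumBelow (λ i → geometricPS k (m ∸ i)) (suc m)
      ≡⟨ cong₂ _+ℤ_ (geometricPS-suc k m) (sumBelow-geometricPS k m) ⟩
    + binomialSum m k +ℤ + binomialSum m (suc k)
      ≡⟨ ℤ.pos-+ (binomialSum m k) _ ⟨
    + binomialSum (suc m) (suc k) ∎
    where open ≡-Reasoning

countAvoiders-zero : ∀ t τ → countAvoiders 0 (forbidden (t ∷ τ)) ≡ 1
countAvoiders-zero t τ = refl

dτ≈det : ∀ k (τ : Vec ℕ (suc k)) → RightExtremal _<_ (toList τ) →
         dτ (toList τ) ≈PS det (suc k) (Mτ (suc k))
dτ≈det k (t ∷ τ) r zero = begin
  + countAvoiders 0 (forbidden (t ∷ toList τ))  ≡⟨ cong +_ (countAvoiders-zero t (toList τ)) ⟩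
  + 1                  ≡⟨ geometricPS-zero k ⟨
  geometricPS k 0      ≡⟨ det-Mτ k 0 ⟨
  det (suc k) (Mτ (suc k)) 0 ∎
  where open ≡-Reasoning
dτ≈det k (t ∷ τ) r (suc m) = begin
  + countAvoiders (suc m) (forbidden (t ∷ toList τ)) ≡⟨ cong +_ (countAvoiders≡binomialSum m r) ⟩
  + binomialSum m (length (toList τ))  ≡⟨ cong (+_ ∘ binomialSum m) (Vec.length-toList τ) ⟩
  + binomialSum m k                    ≡⟨ geometricPS-suc k m ⟨
  geometricPS k (suc m)                ≡⟨ det-Mτ k (suc m) ⟨
  det (suc k) (Mτ (suc k)) (suc m)     ∎
  where open ≡-Reasoning

theorem4 : (k : ℕ) → 1 ≤ k → (τ : Vec ℕ k) →
    isPerm k (toList τ) ≡ true →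
    avoids (toList τ) (2 ∷ 1 ∷ 3 ∷ []) ≡ true →
    avoids (toList τ) (2 ∷ 3 ∷ 1 ∷ []) ≡ true →
      ((i : Fin k) → toℕ i + 1 < k →
        ((j : Fin k) → toℕ i < toℕ j → lookup τ j < lookup τ i)
        ⊎ ((j : Fin k) → toℕ i < toℕ j → lookup τ i < lookup τ j))
      × (dτ (toList τ) ≈PS det k (Mτ k))
theorem4 (suc k) _ τ perm av-213 av-231 =
  (λ i _ → RightExtremal⇒rightMaxOrMin τ r i) , dτ≈det k τ r
  where
    r = avoids⇒RightExtremal (isPerm⇒Unique (suc k) (toList τ) perm) av-213 av-231
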